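{- Let $(W,S)$ be a simply-laced triangle-free Coxeter system and let ${\boldsymbol{\alpha}}$ be a link of rank $r\ge1$. (a) If $\operatorname{supp}_{\llbracket 2\rrbracket}([{\boldsymbol{\alpha}}])=\{s,t\}$ with $m(s,t)=3$, then ${\boldsymbol{\alpha}}_{\llbracket 1,2\rrbracket}=st$ or ${\boldsymbol{\alpha}}_{\llbracket 1,2\rrbracket}=ts$. (b) If $\operatorname{supp}_{\llbracket 2r\rrbracket}([{\boldsymbol{\alpha}}])=\{s,t\}$ with $m(s,t)=3$, then ${\boldsymbol{\alpha}}_{\llbracket 2r,2r+1\rrbracket}=st$ or ${\boldsymbol{\alpha}}_{\llbracket 2r,2r+1\rrbracket}=ts$.
   Context: A Coxeter system $(W,S)$: finite $S$, $W=\langle S\mid (st)^{m(s,t)}=e\rangle$, $m(s,s)=1$, $m(s,t)\in\{2,3,\dots,\infty\}$ for $s\ne t$; simply laced: $m(s,t)\le3$; Coxeter graph $\Gamma$ on $S$ with edge $\{s,t\}$ iff $m(s,t)\ge3$; triangle free: no three-cycles in $\Gamma$. Reduced expression: minimal-length word for its element. Braid move: replace consecutive $sts$ by $tst$ with $m(s,t)=3$; braid class $[{\boldsymbol{\alpha}}]$: reduced expressions reachable from ${\boldsymbol{\alpha}}$ by braid moves. For ${\boldsymbol{\alpha}}=s_{x_1}\cdots s_{x_m}$, ${\boldsymbol{\alpha}}_{\llbracket i,j\rrbracket}=s_{x_i}\cdots s_{x_j}$; $\operatorname{supp}_{\llbracket k\rrbracket}([{\boldsymbol{\alpha}}])$ is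 the set of letters appearing in position $k$ of some element of $[{\boldsymbol{\alpha}}]$. $\llbracket i,i+2\rrbracket$ is a braid shadow of ${\boldsymbol{\alpha}}$ if $s_{x_i}=s_{x_{i+2}}$ and $m(s_{x_i},s_{x_{i+1}})=3$; $\operatorname{bs}([{\boldsymbol{\alpha}}])$ is the set of braid shadows of all elements of $[{\boldsymbol{\alpha}}]$ and $\operatorname{rank}({\boldsymbol{\alpha}})=|\operatorname{bs}([{\boldsymbol{\alpha}}])|$. A reduced expression with $m\ge1$ letters is a link if $m=1$ or $m$ is odd and $\operatorname{bs}([{\boldsymbol{\alpha}}])=\{\llbracket1,3\rrbracket,\dots,\llbracket m-2,m\rrbracket\}$; a link of rank $r$ has $2r+1$ letters. -}

module Defs where

open import Data.Nat using (ℕ; zero; suc; _+_; _*_; _≤_)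
open import Data.Fin using (Fin)
open import Data.List using (List; []; _∷_; _++_; length)
open import Data.Maybe using (Maybe; just; nothing)
open import Data.Product using (Σ; ∃; _×_; _,_)
open import Data.Sum using (_⊎_)
open import Data.Empty using (⊥)
open import Relation.Binary.PropositionalEquality using (_≡_; _≢_)
open import Relation.Binary.Construct.Closure.ReflexiveTransitive using (Star)
open import Relation.Binary.Construct.Closure.Equivalence using (EqClosure)
open import Data.List.Relation.Unary.Unique.Propositional using (Unique)
open import Data.List.Membership.Propositional using (_∈_)

Iff : Set → Set → Set
Iff A B = (A → B) × (B → A)

data ℕ∞ : Set where
  fin : ℕ → ℕ∞
  ∞   : ℕ∞

record CoxeterMatrix (n : ℕ) : Set where
  field
    m      : Fin n → Fin n → ℕ∞
    m-diag : ∀ s → m s s ≡ fin 1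
    m-sym  : ∀ s t → m s t ≡ m t s
    m-off  : ∀ s t → s ≢ t → (m s t ≡ ∞) ⊎ (Σ ℕ λ k → (m s t ≡ fin k) × (2 ≤ k))
open CoxeterMatrix public

module _ {n : ℕ} (M : CoxeterMatrix n) where

  Word : Set
  Word = List (Fin n)

  alt : Fin n → Fin n → ℕ → Word
  alt s t zero    = []
  alt s t (suc k) = s ∷ alt t s k

  -- deleting a relator (st)^{m(s,t)} (m finite) from a word; its equivalence
  -- closure is equality in the monoid (= group, since generators are involutions)
  -- presentation of W
  data RelStep : Word → Word → Set where
    del : ∀ u v s t k → m M s t ≡ fin k → RelStep (u ++ alt s t (2 * k) ++ v) (u ++ v)

  SameElt : Word → Word → Set
  SameElt = EqClosure RelStep

  Reduced : Word → Set
  Reduced α = ∀ β → SameElt α β → length α ≤ length β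

  SimplyLaced : Set
  SimplyLaced = ∀ s t → Σ ℕ λ k → (m M s t ≡ fin k) × (k ≤ 3)

  Edge : Fin n → Fin n → Set
  Edge s t = (m M s t ≡ ∞) ⊎ (Σ ℕ λ k → (m M s t ≡ fin k) × (3 ≤ k))

  TriangleFree : Set
  TriangleFree = ∀ s t u → Edge s t → Edge t u → Edge u s → ⊥

  data BraidStep : Word → Word → Set where
    braid : ∀ u v s t → m M s t ≡ fin 3 →
            BraidStep (u ++ s ∷ t ∷ s ∷ v) (u ++ t ∷ s ∷ t ∷ v)

  InBraidClass : Word → Word → Set
  InBraidClass α β = Star BraidStep α β

  -- 1-indexed letter at position k
  at : Word → ℕ → Maybe (Fin n)
  at xs       zero          = nothing
  at []       (suc k)       = nothing
  at (x ∷ xs) (suc zero)    = just x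
  at (x ∷ xs) (suc (suc k)) = at xs (suc k)

  InSupp : Word → ℕ → Fin n → Set
  InSupp α k x = ∃ λ β → InBraidClass α β × (at β k ≡ just x)

  SuppIs : Word → ℕ → Fin n → Fin n → Set
  SuppIs α k s t = ∀ x → Iff (InSupp α k x) ((x ≡ s) ⊎ (x ≡ t))

  IsShadow : Word → ℕ → Set
  IsShadow β i = Σ (Fin n) λ x → Σ (Fin n) λ y →
    (at β i ≡ just x) × (at β (suc i) ≡ just y) × (at β (suc (suc i)) ≡ just x)
    × (m M x y ≡ fin 3)

  InBS : Word → ℕ → Set
  InBS α i = ∃ λ β → InBraidClass α β × IsShadow β i

  HasRank : Word → ℕ → Set
  HasRank α r = Σ (List ℕ) λ l → Unique l × (length l ≡ r) × (∀ i → Iff (i ∈ l) (InBS α i))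

  Link : Word → Set
  Link α = Reduced α ×
    ((length α ≡ 1) ⊎
     ((Σ ℕ λ j → length α ≡ suc (2 * j)) ×
      (∀ i → Iff (InBS α i) (Σ ℕ λ j → (i ≡ suc (2 * j)) × (suc (2 * j) + 2 ≤ length α)))))

-- A braid move rewrites a window ⟦i,i+2⟧ and touches nothing else, so it
-- keeps the unordered pair of letters in positions k, k+1 unless the window
-- shares exactly one position with ⟦k,k+1⟧, i.e. i = k+1 or i+2 = k.  For a
-- link every braid shadow starts at an odd position ≤ 2r−1, so for k = 1 and
-- k = 2r no such window exists in the whole braid class: the pair in
-- positions k, k+1 is the same for every element of [α], hence the support
-- at position k or k+1 is contained in it, and a two-element support fills it.
module Submission where

open import Defs
open import Data.Nat using (ℕ; zero; suc; _+_; _*_; _≤_; z≤n; s≤s)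
open import Data.Nat.Properties
  using (*-suc; *-cancelˡ-≡; *-monoʳ-≤; +-monoˡ-≤; m≤m+n; m≤n+m; ≤-trans; 1+n≰n; suc-injective; even≢odd)
open import Data.Fin using (Fin; toℕ)
open import Data.Fin.Properties using (injective⇒≤; toℕ-injective; toℕ≤pred[n])
open import Data.List using (List; []; _∷_; _++_; length)
open import Data.List.Properties using (length-++)
open import Data.List.Membership.Propositional using (_∈_)
open import Data.List.Membership.Setoid.Properties using (index-injective)
open import Data.List.Relation.Unary.Any using (index)
open import Data.Maybe using (just)
open import Data.Maybe.Properties using (just-injective)
open import Data.Product using (Σ; _×_; _,_; proj₁; proj₂)
open import Data.Sum using (_⊎_; inj₁; inj₂)
open import Data.Empty using (⊥-elim)
open import Function.Definitions using (Injective)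
open import Relation.Nullary using (¬_)
open import Relation.Binary.PropositionalEquality
  using (_≡_; _≢_; refl; sym; trans; cong; subst; setoid)
open import Relation.Binary.Construct.Closure.ReflexiveTransitive
  using (ε; _◅_; _◅◅_)

injective⇒≤length : ∀ {a} {A : Set a} {N} {l : List A} (f : Fin N → A) →
  Injective _≡_ _≡_ f → (∀ i → f i ∈ l) → N ≤ length l
injective⇒≤length f f-inj f∈l = injective⇒≤ {f = λ i → index (f∈l i)}
  (λ same-index → f-inj (index-injective (setoid _) (f∈l _) (f∈l _) same-index))

module _ {n : ℕ} (M : CoxeterMatrix n) where

  m≡3⇒≢ : ∀ {s t} → m M s t ≡ fin 3 → s ≢ t
  m≡3⇒≢ {s} m≡3 refl with trans (sym (m-diag M s)) m≡3
  ... | ()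

  at⇒≤length : ∀ (β : Word M) k {x} → at M β k ≡ just x → k ≤ length β
  at⇒≤length (c ∷ β) (suc zero)    _  = s≤s z≤n
  at⇒≤length (c ∷ β) (suc (suc k)) eq = s≤s (at⇒≤length β (suc k) eq)

  braidClass-length : ∀ {γ δ} → InBraidClass M γ δ → length γ ≡ length δ
  braidClass-length ε = refl
  braidClass-length (braid u v _ _ _ ◅ rest) =
    trans (trans (length-++ u) (sym (length-++ u))) (braidClass-length rest)

  isShadow-++ : ∀ (u : Word M) v x y → m M x y ≡ fin 3 →
    IsShadow M (u ++ x ∷ y ∷ x ∷ v) (suc (length u))
  isShadow-++ []      v x y m≡3 = x , y , refl , refl , refl , m≡3
  isShadow-++ (c ∷ u) v x y m≡3 = isShadow-++ u v x y m≡3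

  inBS-++ : ∀ {α} u v x y → InBraidClass M α (u ++ x ∷ y ∷ x ∷ v) →
    m M x y ≡ fin 3 → InBS M α (suc (length u))
  inBS-++ u v x y c m≡3 = _ , c , isShadow-++ u v x y m≡3

  inBS⇒≤length : ∀ {α i} → InBS M α i → 2 + i ≤ length α
  inBS⇒≤length (β , c , x , y , _ , _ , at₃ , _) =
    subst (_ ≤_) (sym (braidClass-length c)) (at⇒≤length β _ at₃)

  SamePair : ℕ → Word M → Word M → Set
  SamePair k γ δ = ((at M γ k ≡ at M δ k) × (at M γ (suc k) ≡ at M δ (suc k)))
                 ⊎ ((at M γ k ≡ at M δ (suc k)) × (at M γ (suc k) ≡ at M δ k))

  samePair-trans : ∀ {k α β γ} → SamePair k α β → SamePair k β γ → SamePair k α γ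
  samePair-trans (inj₁ (p , q)) (inj₁ (p′ , q′)) = inj₁ (trans p p′ , trans q q′)
  samePair-trans (inj₁ (p , q)) (inj₂ (p′ , q′)) = inj₂ (trans p p′ , trans q q′)
  samePair-trans (inj₂ (p , q)) (inj₁ (p′ , q′)) = inj₂ (trans p q′ , trans q p′)
  samePair-trans (inj₂ (p , q)) (inj₂ (p′ , q′)) = inj₁ (trans p q′ , trans q p′)

  Straddles : ℕ → ℕ → Set
  Straddles i k = (i ≡ suc k) ⊎ (2 + i ≡ k)

  braid-samePair : ∀ (u : Word M) v x y k →
    SamePair k (u ++ x ∷ y ∷ x ∷ v) (u ++ y ∷ x ∷ y ∷ v) ⊎ Straddles (suc (length u)) k
  braid-samePair []      v x y zero                      = inj₂ (inj₁ refl)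
  braid-samePair []      v x y (suc zero)                = inj₁ (inj₂ (refl , refl))
  braid-samePair []      v x y (suc (suc zero))          = inj₁ (inj₂ (refl , refl))
  braid-samePair []      v x y (suc (suc (suc zero)))    = inj₂ (inj₂ refl)
  braid-samePair []      v x y (suc (suc (suc (suc k)))) = inj₁ (inj₁ (refl , refl))
  braid-samePair (c ∷ u) v x y zero                      = inj₁ (inj₁ (refl , refl))
  braid-samePair (c ∷ u) v x y (suc zero) with braid-samePair u v x y zero
  ... | inj₁ (inj₁ (_ , q))     = inj₁ (inj₁ (refl , q))
  -- position 0 is empty in both words, so a swap of (0,1) fixes position 1
  ... | inj₁ (inj₂ (p , q))     = inj₁ (inj₁ (refl , trans q p))
  ... | inj₂ (inj₁ i≡1)         = inj₂ (inj₁ (cong suc i≡1))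
  ... | inj₂ (inj₂ ())
  braid-samePair (c ∷ u) v x y (suc (suc k)) with braid-samePair u v x y (suc k)
  ... | inj₁ same               = inj₁ same
  ... | inj₂ (inj₁ i≡k+1)       = inj₂ (inj₁ (cong suc i≡k+1))
  ... | inj₂ (inj₂ i+2≡k)       = inj₂ (inj₂ (cong suc i+2≡k))

  ShadowFreeAround : Word M → ℕ → Set
  ShadowFreeAround α k = ∀ i → InBS M α i → ¬ Straddles i k

  samePair-braidClass : ∀ {α k γ δ} → ShadowFreeAround α k →
    InBraidClass M α γ → InBraidClass M γ δ → SamePair k γ δ
  samePair-braidClass free α→γ ε = inj₁ (refl , refl)
  samePair-braidClass {k = k} {δ = δ} free α→γ (step@(braid u v x y m≡3) ◅ γ′→δ)
    with braid-samePair u v x y k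
  ... | inj₁ same = samePair-trans {k} {γ = δ} same
                      (samePair-braidClass free (α→γ ◅◅ (step ◅ ε)) γ′→δ)
  ... | inj₂ straddle = ⊥-elim (free _ (inBS-++ u v x y α→γ m≡3) straddle)

  InPair : Word M → ℕ → Fin n → Set
  InPair β k x = (at M β k ≡ just x) ⊎ (at M β (suc k) ≡ just x)

  samePair-inPair : ∀ {k γ δ x} → SamePair k γ δ → InPair δ k x → InPair γ k x
  samePair-inPair (inj₁ (p , _)) (inj₁ a) = inj₁ (trans p a)
  samePair-inPair (inj₁ (_ , q)) (inj₂ a) = inj₂ (trans q a)
  samePair-inPair (inj₂ (_ , q)) (inj₁ a) = inj₂ (trans q a)
  samePair-inPair (inj₂ (p , _)) (inj₂ a) = inj₁ (trans p a)

  inSupp⇒inPair : ∀ {α k x} → ShadowFreeAround α k → InSupp M α k x → InPair α k x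
  inSupp⇒inPair {α} {k} free (β , α→β , a) =
    samePair-inPair {k} {α} {β} (samePair-braidClass free ε α→β) (inj₁ a)

  inSupp-suc⇒inPair : ∀ {α k x} → ShadowFreeAround α k → InSupp M α (suc k) x → InPair α k x
  inSupp-suc⇒inPair {α} {k} free (β , α→β , a) =
    samePair-inPair {k} {α} {β} (samePair-braidClass free ε α→β) (inj₂ a)

  PairIs : Word M → ℕ → Fin n → Fin n → Set
  PairIs α k s t = ((at M α k ≡ just s) × (at M α (suc k) ≡ just t))
                 ⊎ ((at M α k ≡ just t) × (at M α (suc k) ≡ just s))

  distinct-inPair⇒pairIs : ∀ {α k s t} → s ≢ t →
    InPair α k s → InPair α k t → PairIs α k s t
  distinct-inPair⇒pairIs s≢t (inj₁ a) (inj₁ b) = ⊥-elim (s≢t (just-injective (trans (sym a) b)))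
  distinct-inPair⇒pairIs s≢t (inj₁ a) (inj₂ b) = inj₁ (a , b)
  distinct-inPair⇒pairIs s≢t (inj₂ a) (inj₁ b) = inj₂ (b , a)
  distinct-inPair⇒pairIs s≢t (inj₂ a) (inj₂ b) = ⊥-elim (s≢t (just-injective (trans (sym a) b)))

  suppIs⇒pairIs : ∀ {α k s t} → ShadowFreeAround α k → s ≢ t →
    SuppIs M α k s t → PairIs α k s t
  suppIs⇒pairIs {α} {k} free s≢t supp = distinct-inPair⇒pairIs {α} {k} s≢t
    (inSupp⇒inPair free (proj₂ (supp _) (inj₁ refl)))
    (inSupp⇒inPair free (proj₂ (supp _) (inj₂ refl)))

  suppIs-suc⇒pairIs : ∀ {α k s t} → ShadowFreeAround α k → s ≢ t →
    SuppIs M α (suc k) s t → PairIs α k s t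
  suppIs-suc⇒pairIs {α} {k} free s≢t supp = distinct-inPair⇒pairIs {α} {k} s≢t
    (inSupp-suc⇒inPair free (proj₂ (supp _) (inj₁ refl)))
    (inSupp-suc⇒inPair free (proj₂ (supp _) (inj₂ refl)))

  link-shadows : ∀ {α} → Link M α → ∀ i →
    Iff (InBS M α i) (Σ ℕ λ j → (i ≡ suc (2 * j)) × (suc (2 * j) + 2 ≤ length α))
  link-shadows (_ , inj₂ (_ , bs)) = bs
  link-shadows {α} (_ , inj₁ len≡1) i =
    (λ shadow → ⊥-elim (2≰1 (≤-trans (m≤m+n 2 i) (inBS⇒≤length shadow))))
    , (λ (j , _ , fits) → ⊥-elim (2≰1 (≤-trans (m≤n+m 2 (suc (2 * j))) fits)))
    where
    2≰1 : ¬ (2 ≤ length α)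
    2≰1 2≤len with subst (2 ≤_) len≡1 2≤len
    ... | s≤s ()

  -- A shadow at 2r+1 would force all of 1, 3, …, 2r+1 into bs([α]), i.e. r+1 shadows.
  link-¬inBS-beyondRank : ∀ {α r} → Link M α → HasRank M α r → ¬ InBS M α (suc (2 * r))
  link-¬inBS-beyondRank {α} {r} link (l , _ , len≡r , l≡bs) shadow =
    1+n≰n (subst (suc r ≤_) len≡r (injective⇒≤length odd odd-injective odd∈l))
    where
    odd : Fin (suc r) → ℕ
    odd i = suc (2 * toℕ i)

    odd-injective : Injective _≡_ _≡_ odd
    odd-injective eq = toℕ-injective (*-cancelˡ-≡ _ _ 2 (suc-injective eq))

    last-fits : suc (2 * r) + 2 ≤ length α
    last-fits with proj₁ (link-shadows link _) shadow
    ... | j , eq , fits = subst (λ i → i + 2 ≤ length α) (sym eq) fits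

    odd∈l : ∀ i → odd i ∈ l
    odd∈l i = proj₂ (l≡bs _) (proj₂ (link-shadows link _) (toℕ i , refl ,
      ≤-trans (+-monoˡ-≤ 2 (s≤s (*-monoʳ-≤ 2 (toℕ≤pred[n] i)))) last-fits))

  link-shadowFreeAround-1 : ∀ {α} → Link M α → ShadowFreeAround α 1
  link-shadowFreeAround-1 link _ shadow (inj₁ refl) with proj₁ (link-shadows link 2) shadow
  ... | j , 2≡odd , _ = even≢odd 1 j 2≡odd
  link-shadowFreeAround-1 link _ shadow (inj₂ ())

  link-shadowFreeAround-2r : ∀ {α r} → Link M α → HasRank M α r → ShadowFreeAround α (2 * r)
  link-shadowFreeAround-2r link rank _ shadow (inj₁ refl) =
    link-¬inBS-beyondRank link rank shadow
  link-shadowFreeAround-2r {r = r} link rank i shadow (inj₂ i+2≡2r)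
    with proj₁ (link-shadows link i) shadow
  ... | j , refl , _ = even≢odd r (suc j) (sym (trans (cong suc (*-suc 2 j)) i+2≡2r))

lemma5p2 : ∀ {n} (M : CoxeterMatrix n) → SimplyLaced M → TriangleFree M →
    ∀ (α : List (Fin n)) (r : ℕ) → Link M α → HasRank M α r → 1 ≤ r →
    (∀ s t → m M s t ≡ fin 3 → SuppIs M α 2 s t →
       ((at M α 1 ≡ just s) × (at M α 2 ≡ just t)) ⊎ ((at M α 1 ≡ just t) × (at M α 2 ≡ just s)))
    ×
    (∀ s t → m M s t ≡ fin 3 → SuppIs M α (2 * r) s t →
       ((at M α (2 * r) ≡ just s) × (at M α (suc (2 * r)) ≡ just t))
       ⊎ ((at M α (2 * r) ≡ just t) × (at M α (suc (2 * r)) ≡ just s)))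
lemma5p2 M _ _ α r link rank _ =
    (λ s t m≡3 → suppIs-suc⇒pairIs M {α} {1} (link-shadowFreeAround-1 M link) (m≡3⇒≢ M m≡3))
  , (λ s t m≡3 → suppIs⇒pairIs M {α} {2 * r}
                   (link-shadowFreeAround-2r M link rank) (m≡3⇒≢ M m≡3))
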